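{- Let $G=(V,E)$ be a graph and $\ell\ge 0$ an integer. If there exist two disjoint subsets $A,B\subseteq V$ with $|B|=2^{|A|}$ which are $\ell$-disconnectable, then the distance VC-dimension of $G$ is at least $|A|$.
   Context: All graphs are finite and simple; $d_H$ denotes shortest-path distance in a graph $H$ ($+\infty$ if no path), $B_H(x,k)=\{y:d_H(x,y)\le k\}$. For disjoint $A,B\subseteq V$, a family $\mathcal{S}=(S_{a,b})_{(a,b)\in A\times B}$ of vertex sets, each disjoint from $A\cup B$, is $\ell$-disconnecting for $A,B$ if for every subset $C\subseteq A\times B$ and every pair $(a,b)\in A\times B$, we have $d_{G'}(a,b)>\ell$ in the graph $G'=G\setminus\bigcup_{(a',b')\in C}S_{a',b'}$ if and only if $(a,b)\in C$. The pair $A,B$ is $\ell$-disconnectable if such a family exists. The $B$-hypergraph of a graph $H$ has vertex set $V(H)$ and hyperedges all balls $B_H(v,k)$, $v\in V(H)$, $k\ge0$. A set $X$ is shattered by a hypergraph if for every $X'\subseteq X$ some hyperedge $e$ satisfies $e\cap X=X'$; the VC-dimension is the maximum size of a shattered set. The distance VC-dimension of $G$ is the maximum over induced subgraphs $G'$ of $G$ of the VC-dimension of the $B$-hypergraph of $G'$. -}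

module Defs where

open import Data.Nat using (ℕ; zero; suc; _≤_; _>_)
open import Data.Fin using (Fin)
open import Data.Bool using (Bool; true; false)
open import Data.Fin.Subset using (Subset; _∈_; _∉_; _⊆_; ∣_∣)
open import Data.Product using (Σ; ∃; _×_; _,_)
open import Relation.Nullary using (¬_)
open import Relation.Binary.PropositionalEquality using (_≡_)
open import Function.Bundles using (_⇔_)

record Graph (n : ℕ) : Set where
  field
    Adj   : Fin n → Fin n → Bool
    sym   : ∀ x y → Adj x y ≡ Adj y x
    irrefl : ∀ x → Adj x x ≡ false
open Graph public

-- DistLe G P k x y : in the subgraph of G induced by the vertices satisfying P,
-- there is a walk from x to y (inside P) of length ≤ k, i.e. d_{G[P]}(x,y) ≤ k.
data DistLe {n : ℕ} (G : Graph n) (P : Fin n → Set) : ℕ → Fin n → Fin n → Set where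
  here : ∀ {k x} → P x → DistLe G P k x x
  step : ∀ {k x y z} → P x → Adj G x y ≡ true → DistLe G P k y z → DistLe G P (suc k) x z

Disjoint : ∀ {n} → Subset n → Subset n → Set
Disjoint A B = ∀ x → x ∈ A → x ∉ B

-- Vertices remaining after deleting ⋃_{(a',b') ∈ C} S_{a',b'}, where C ⊆ A × B
-- is given by its characteristic function (pairs outside A × B are ignored).
Remaining : ∀ {n} → (A B : Subset n) → (S : Fin n → Fin n → Subset n) →
            (C : Fin n → Fin n → Bool) → Fin n → Set
Remaining A B S C x =
  ¬ (∃ λ a' → ∃ λ b' → a' ∈ A × b' ∈ B × C a' b' ≡ true × x ∈ S a' b')

record IsDisconnecting {n} (G : Graph n) (ℓ : ℕ) (A B : Subset n)
                       (S : Fin n → Fin n → Subset n) : Set where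
  field
    avoidA : ∀ a b → a ∈ A → b ∈ B → ∀ x → x ∈ S a b → x ∉ A
    avoidB : ∀ a b → a ∈ A → b ∈ B → ∀ x → x ∈ S a b → x ∉ B
    separates : ∀ (C : Fin n → Fin n → Bool) a b → a ∈ A → b ∈ B →
      (¬ DistLe G (Remaining A B S C) ℓ a b) ⇔ (C a b ≡ true)

Disconnectable : ∀ {n} → Graph n → ℕ → Subset n → Subset n → Set
Disconnectable G ℓ A B = ∃ λ S → IsDisconnecting G ℓ A B S

InBall : ∀ {n} → Graph n → Subset n → Fin n → ℕ → Fin n → Set
InBall G U v k y = DistLe G (λ x → x ∈ U) k v y

ShatteredB : ∀ {n} → Graph n → Subset n → Subset n → Set
ShatteredB G U X = ∀ X' → X' ⊆ X →
  ∃ λ v → ∃ λ k → v ∈ U × (∀ x → x ∈ X → (InBall G U v k x ⇔ x ∈ X'))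

IsDistVCDim : ∀ {n} → Graph n → ℕ → Set
IsDistVCDim G d =
  (∃ λ U → ∃ λ X → X ⊆ U × ShatteredB G U X × ∣ X ∣ ≡ d) ×
  (∀ U X → X ⊆ U → ShatteredB G U X → ∣ X ∣ ≤ d)

module Submission where

-- Let S be an ℓ-disconnecting family for A, B with ∣B∣ = 2^∣A∣.
-- Since B has as many elements as A has subsets, there is a labelling
-- L : vertex → subset of A under which every subset X ⊆ A is the label of some
-- b ∈ B.  Delete S_{a,b} for exactly those pairs with a ∉ L b, and let U be the
-- set of surviving vertices; A and B survive because S avoids them.  By the
-- disconnecting property, for a ∈ A and b ∈ B we get d_{G[U]}(b,a) ≤ ℓ iff
-- a ∈ L b, i.e. the ball of radius ℓ around b in G[U] meets A exactly in L b.
-- Hence A is shattered by the B-hypergraph of G[U], and maximality of the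
-- distance VC-dimension d gives ∣A∣ ≤ d.

open import Defs
open import Data.Nat using (ℕ; zero; suc; _≤_; _^_; _+_; s≤s)
open import Data.Nat.Properties using (≤-reflexive; +-identityʳ)
open import Data.Fin using (Fin; zero; suc)
open import Data.Fin.Properties using (any?) renaming (_≟_ to _≟ᶠ_)
open import Data.Fin.Subset using (Subset; ∣_∣; _⊆_; inside; outside) renaming (_∈_ to _∈ˢ_; _∉_ to _∉ˢ_)
open import Data.Fin.Subset.Properties using (_∈?_; drop-∷-⊆)
open import Data.Vec using (_∷_; []; tabulate; here; there)
open import Data.Vec.Properties using (lookup⇒[]=; []=⇒lookup; lookup∘tabulate)
open import Data.Bool using (Bool; true; not)
open import Data.Bool.Properties using (T-≡) renaming (_≟_ to _≟ᵇ_)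
open import Data.List using (List; []; _∷_; map; length; _++_)
open import Data.List.Properties using (length-map; length-++)
open import Data.List.Relation.Unary.Any using (here; there)
open import Data.List.Membership.Propositional using () renaming (_∈_ to _∈ˡ_)
open import Data.List.Membership.Propositional.Properties using (∈-map⁺; ∈-++⁺ˡ; ∈-++⁺ʳ)
open import Data.Product using (∃; _×_; _,_)
open import Data.Empty using (⊥-elim)
open import Relation.Nullary using (¬_; Dec; yes; no; does)
open import Relation.Nullary.Decidable using (isYes; _×-dec_; ¬?; toWitness; fromWitness; decidable-stable)
open import Relation.Binary.PropositionalEquality using (_≡_; refl; trans; cong; cong₂; module ≡-Reasoning) renaming (sym to ≡-sym)
open import Function using (_∘_)
open import Function.Bundles using (_⇔_; mk⇔; Equivalence)
open import Function.Properties.Equivalence using () renaming (refl to ⇔-refl; trans to ⇔-trans)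
open import Function.Related.TypeIsomorphisms using (→-cong-⇔)

⇔-from-¬⇔¬ : ∀ {P Q : Set} → Dec P → Dec Q → ((¬ P) ⇔ (¬ Q)) → P ⇔ Q
⇔-from-¬⇔¬ P? Q? ¬P⇔¬Q = mk⇔
  (λ p → decidable-stable Q? (λ ¬q → Equivalence.from ¬P⇔¬Q ¬q p))
  (λ q → decidable-stable P? (λ ¬p → Equivalence.to ¬P⇔¬Q ¬p q))

module Walks {n : ℕ} (G : Graph n) where

  weaken : ∀ {P Q : Fin n → Set} {k x y} →
           (∀ z → P z → Q z) → DistLe G P k x y → DistLe G Q k x y
  weaken P⊆Q (here px)         = here (P⊆Q _ px)
  weaken P⊆Q (step px xy walk) = step (P⊆Q _ px) xy (weaken P⊆Q walk)

  extend : ∀ {P : Fin n → Set} {k x y z} →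
           DistLe G P k x y → Adj G y z ≡ true → P z → DistLe G P (suc k) x z
  extend (here px)         yz pz = step px yz (here pz)
  extend (step px xw walk) yz pz = step px xw (extend walk yz pz)

  reverse : ∀ {P : Fin n → Set} {k x y} → DistLe G P k x y → DistLe G P k y x
  reverse (here px) = here px
  reverse {x = x} (step {y = y} px xy walk) =
    extend (reverse walk) (trans (Graph.sym G y x) xy) px

  distLe? : ∀ {P : Fin n → Set} → (∀ x → Dec (P x)) →
            ∀ k x y → Dec (DistLe G P k x y)
  distLe? P? k x y with P? x | x ≟ᶠ y
  ... | no ¬px | _        = no λ { (here px) → ¬px px ; (step px _ _) → ¬px px }
  ... | yes px | yes refl = yes (here px)
  distLe? P? zero x y | yes px | no x≢y = no λ { (here _) → x≢y refl }
  distLe? P? (suc k) x y | yes px | no x≢y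
    with any? (λ w → (Adj G x w ≟ᵇ true) ×-dec distLe? P? k w y)
  ... | yes (w , xw , walk) = yes (step px xw walk)
  ... | no ¬first           = no λ { (here _) → x≢y refl
                                   ; (step _ xw walk) → ¬first (_ , xw , walk) }

open Walks

comprehension : ∀ {n} {P : Fin n → Set} → (∀ x → Dec (P x)) → Subset n
comprehension P? = tabulate (λ x → isYes (P? x))

∈-comprehension : ∀ {n} {P : Fin n → Set} (P? : ∀ x → Dec (P x)) x →
                  x ∈ˢ comprehension P? ⇔ P x
∈-comprehension P? x = mk⇔
  (λ x∈ → toWitness {a? = P? x} (Equivalence.from T-≡
            (trans (≡-sym (lookup∘tabulate f x)) ([]=⇒lookup x∈))))
  (λ px → lookup⇒[]= x _
            (trans (lookup∘tabulate f x) (Equivalence.to T-≡ (fromWitness {a? = P? x} px))))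
  where f = λ y → isYes (P? y)

subsetsOf : ∀ {n} → Subset n → List (Subset n)
subsetsOf []            = [] ∷ []
subsetsOf (outside ∷ A) = map (outside ∷_) (subsetsOf A)
subsetsOf (inside ∷ A)  = map (outside ∷_) (subsetsOf A) ++ map (inside ∷_) (subsetsOf A)

length-subsetsOf : ∀ {n} (A : Subset n) → length (subsetsOf A) ≡ 2 ^ ∣ A ∣
length-subsetsOf [] = refl
length-subsetsOf (outside ∷ A) =
  trans (length-map (outside ∷_) (subsetsOf A)) (length-subsetsOf A)
length-subsetsOf (inside ∷ A) = begin
  length (map (outside ∷_) (subsetsOf A) ++ map (inside ∷_) (subsetsOf A))
    ≡⟨ length-++ (map (outside ∷_) (subsetsOf A)) ⟩
  length (map (outside ∷_) (subsetsOf A)) + length (map (inside ∷_) (subsetsOf A))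
    ≡⟨ cong₂ _+_ (length-map (outside ∷_) (subsetsOf A)) (length-map (inside ∷_) (subsetsOf A)) ⟩
  length (subsetsOf A) + length (subsetsOf A)
    ≡⟨ cong₂ _+_ (length-subsetsOf A) (length-subsetsOf A) ⟩
  2 ^ ∣ A ∣ + 2 ^ ∣ A ∣
    ≡⟨ cong (2 ^ ∣ A ∣ +_) (≡-sym (+-identityʳ (2 ^ ∣ A ∣))) ⟩
  2 ^ ∣ inside ∷ A ∣ ∎
  where open ≡-Reasoning

subsetsOf-complete : ∀ {n} (A X : Subset n) → X ⊆ A → X ∈ˡ subsetsOf A
subsetsOf-complete [] [] _ = here refl
subsetsOf-complete (outside ∷ A) (outside ∷ X) X⊆A =
  ∈-map⁺ (outside ∷_) (subsetsOf-complete A X (drop-∷-⊆ X⊆A))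
subsetsOf-complete (outside ∷ A) (inside ∷ X) X⊆A with X⊆A here
... | ()
subsetsOf-complete (inside ∷ A) (outside ∷ X) X⊆A =
  ∈-++⁺ˡ (∈-map⁺ (outside ∷_) (subsetsOf-complete A X (drop-∷-⊆ X⊆A)))
subsetsOf-complete (inside ∷ A) (inside ∷ X) X⊆A =
  ∈-++⁺ʳ _ (∈-map⁺ (inside ∷_) (subsetsOf-complete A X (drop-∷-⊆ X⊆A)))

labelling : ∀ {n} {Y : Set} → Y → (B : Subset n) (ys : List Y) → length ys ≤ ∣ B ∣ →
            ∃ λ (L : Fin n → Y) → ∀ {y} → y ∈ˡ ys → ∃ λ b → b ∈ˢ B × L b ≡ y
labelling default B [] _ = (λ _ → default) , λ ()
labelling default [] (y ∷ ys) ()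
labelling default (inside ∷ B) (y ∷ ys) (s≤s ys≤B) with labelling default B ys ys≤B
... | L , labelled = L′ , labelled′
  where
  L′ : Fin _ → _
  L′ zero    = y
  L′ (suc b) = L b
  labelled′ : ∀ {y′} → y′ ∈ˡ y ∷ ys → ∃ λ b → b ∈ˢ inside ∷ B × L′ b ≡ y′
  labelled′ (here refl) = zero , here , refl
  labelled′ (there y′∈ys) with labelled y′∈ys
  ... | b , b∈B , Lb≡y′ = suc b , there b∈B , Lb≡y′
labelling default (outside ∷ B) ys ys≤B with labelling default B ys ys≤B
... | L , labelled = L′ , labelled′
  where
  L′ : Fin _ → _
  L′ zero    = default
  L′ (suc b) = L b
  labelled′ : ∀ {y} → y ∈ˡ ys → ∃ λ b → b ∈ˢ outside ∷ B × L′ b ≡ y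
  labelled′ y∈ys with labelled y∈ys
  ... | b , b∈B , Lb≡y = suc b , there b∈B , Lb≡y

module LabelledDeletion {n : ℕ} (G : Graph n) (ℓ : ℕ) (A B : Subset n)
                        (S : Fin n → Fin n → Subset n) (isD : IsDisconnecting G ℓ A B S)
                        (L : Fin n → Subset n) where

  open IsDisconnecting isD

  cut : Fin n → Fin n → Bool
  cut a b = not (does (a ∈? L b))

  cut⇔∉ : ∀ a b → cut a b ≡ true ⇔ a ∉ˢ L b
  cut⇔∉ a b with a ∈? L b
  ... | yes a∈Lb = mk⇔ (λ ()) (λ a∉Lb → ⊥-elim (a∉Lb a∈Lb))
  ... | no a∉Lb  = mk⇔ (λ _ → a∉Lb) (λ _ → refl)

  Survives : Fin n → Set
  Survives = Remaining A B S cut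

  survives? : ∀ x → Dec (Survives x)
  survives? x = ¬? (any? λ a → any? λ b →
    (a ∈? A) ×-dec (b ∈? B) ×-dec (cut a b ≟ᵇ true) ×-dec (x ∈? S a b))

  U : Subset n
  U = comprehension survives?

  A⊆U : A ⊆ U
  A⊆U {x} x∈A = Equivalence.from (∈-comprehension survives? x)
    λ (a , b , a∈A , b∈B , _ , x∈S) → avoidA a b a∈A b∈B x x∈S x∈A

  B⊆U : B ⊆ U
  B⊆U {x} x∈B = Equivalence.from (∈-comprehension survives? x)
    λ (a , b , a∈A , b∈B , _ , x∈S) → avoidB a b a∈A b∈B x x∈S x∈B

  inBall⇔walk : ∀ a b → InBall G U b ℓ a ⇔ DistLe G Survives ℓ a b
  inBall⇔walk a b = mk⇔
    (reverse G ∘ weaken G (λ x → Equivalence.to (∈-comprehension survives? x)))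
    (reverse G ∘ weaken G (λ x → Equivalence.from (∈-comprehension survives? x)))

  outsideBall⇔∉ : ∀ a b → a ∈ˢ A → b ∈ˢ B → (¬ InBall G U b ℓ a) ⇔ (a ∉ˢ L b)
  outsideBall⇔∉ a b a∈A b∈B =
    ⇔-trans (→-cong-⇔ (inBall⇔walk a b) ⇔-refl)
            (⇔-trans (separates cut a b a∈A b∈B) (cut⇔∉ a b))

  ball∩A : ∀ a b → a ∈ˢ A → b ∈ˢ B → InBall G U b ℓ a ⇔ a ∈ˢ L b
  ball∩A a b a∈A b∈B =
    ⇔-from-¬⇔¬ (distLe? G (_∈? U) ℓ b a) (a ∈? L b) (outsideBall⇔∉ a b a∈A b∈B)

theorem15 : ∀ {n} (G : Graph n) (ℓ : ℕ) (A B : Subset n) →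
    Disjoint A B → ∣ B ∣ ≡ 2 ^ ∣ A ∣ → Disconnectable G ℓ A B →
    ∀ d → IsDistVCDim G d → ∣ A ∣ ≤ d
theorem15 G ℓ A B _ ∣B∣≡2^∣A∣ (S , isD) d (_ , maximal)
  with labelling A B (subsetsOf A)
         (≤-reflexive (trans (length-subsetsOf A) (≡-sym ∣B∣≡2^∣A∣)))
... | L , labelled = maximal U A A⊆U shattered
  where
  open LabelledDeletion G ℓ A B S isD L

  shattered : ShatteredB G U A
  shattered X X⊆A with labelled (subsetsOf-complete A X X⊆A)
  ... | b , b∈B , refl = b , ℓ , B⊆U b∈B , λ a a∈A → ball∩A a b a∈A b∈B
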